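{- Let $\mathfrak{plc}_I$ be a tropical plactic algebra with ordered generators $\{\mathfrak a_i:i\in I\}$. Let $m\ge1$ and let $L_m=[\ell_1,\dots,\ell_m]$ be a nondecreasing sequence of elements of $I$ (i.e. $\ell_1\le\ell_2\le\cdots\le\ell_m$). Then $$\mathfrak a_{\ell_1}\cdots\mathfrak a_{\ell_m}=\sum_{S}\ \prod_{s\in S}\mathfrak a_s,$$ where the sum runs over all nonempty (necessarily nondecreasing) subsequences $S$ of $L_m$, and each product $\prod_{s\in S}\mathfrak a_s$ is taken in the order of the subsequence $S$.
   Context: Let $I\subseteq\mathbb N$ be nonempty. A tropical plactic algebra $\mathfrak{plc}_I$ is a semiring $(\mathfrak{plc}_I,+,\cdot)$ (commutative additive monoid with zero $\mathfrak o$, multiplicative monoid with identity $\mathfrak e$, distributivity), additively idempotent, generated by a totally ordered set $\{\mathfrak a_i:i\in I\}$, and satisfying for all generators $\mathfrak a\le\mathfrak b\le\mathfrak c$: (TPA1) $\mathfrak a=\mathfrak e+\mathfrak a$; (TPA2) $\mathfrak b\mathfrak a=\mathfrak a+\mathfrak b$ if $\mathfrak b>\mathfrak a$; (TPA3) $\mathfrak a(\mathfrak b+\mathfrak c)=\mathfrak a\mathfrak b+\mathfrak c$; (TPA4) $(\mathfrak a+\mathfrak b)\mathfrak c=\mathfrak a+\mathfrak b\mathfrak c$. A subsequence of a sequence $[\ell_1,\dots,\ell_m]$ is a sequence $[\ell_{t_1},\dots,\ell_{t_k}]$ with $t_1<\cdots<t_k$. -}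

module Defs where

open import Level using (Level; _⊔_; suc)
open import Algebra.Bundles using (Semiring)
open import Data.Nat using (ℕ; _≤_; _<_)
open import Data.Bool using (not)
open import Data.List using (List; []; _∷_; map; _++_; foldr; null; filterᵇ)
open import Data.List.Relation.Unary.All using (All)
open import Data.Product using (Σ; ∃; _×_)
open import Function.Definitions using (Injective)
open import Relation.Binary.PropositionalEquality using (_≡_)

-- All subsequences of a list, by positions: each element is kept or dropped
-- (so a list of length m has 2^m subsequences, counted with position multiplicity).
subsequences : ∀ {a} {A : Set a} → List A → List (List A)
subsequences []       = [] ∷ []
subsequences (x ∷ xs) = map (x ∷_) (subsequences xs) ++ subsequences xs

nonemptySubsequences : ∀ {a} {A : Set a} → List A → List (List A)
nonemptySubsequences xs = filterᵇ (λ s → not (null s)) (subsequences xs)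

data Nondecreasing : List ℕ → Set where
  []  : Nondecreasing []
  [_] : ∀ x → Nondecreasing (x ∷ [])
  _∷_ : ∀ {x y ys} → x ≤ y → Nondecreasing (y ∷ ys) → Nondecreasing (x ∷ y ∷ ys)

-- A tropical plactic algebra over index set I ⊆ ℕ (I given as a predicate),
-- generators 𝔞 i (i ∈ I), ordered as their indices.
record TropicalPlacticAlgebra {c ℓ} (I : ℕ → Set) : Set (suc (c ⊔ ℓ)) where
  field
    semiring : Semiring c ℓ
  open Semiring semiring public
  Σ⟨_⟩ : List Carrier → Carrier
  Σ⟨ xs ⟩ = foldr _+_ 0# xs
  Π⟨_⟩ : List Carrier → Carrier
  Π⟨ xs ⟩ = foldr _*_ 1# xs
  field
    I-nonempty : ∃ I
    +-idem     : ∀ x → x + x ≈ x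
    𝔞          : ℕ → Carrier
    𝔞-injective : ∀ i j → I i → I j → 𝔞 i ≈ 𝔞 j → i ≡ j
    generated  : ∀ x → Σ (List (List ℕ)) λ ws →
                   All (All I) ws × (x ≈ Σ⟨ map (λ w → Π⟨ map 𝔞 w ⟩) ws ⟩)
    TPA1 : ∀ i → I i → 𝔞 i ≈ 1# + 𝔞 i
    TPA2 : ∀ i j → I i → I j → i < j → 𝔞 j * 𝔞 i ≈ 𝔞 i + 𝔞 j
    TPA3 : ∀ i j k → I i → I j → I k → i ≤ j → j ≤ k →
             𝔞 i * (𝔞 j + 𝔞 k) ≈ 𝔞 i * 𝔞 j + 𝔞 k
    TPA4 : ∀ i j k → I i → I j → I k → i ≤ j → j ≤ k →
             (𝔞 i + 𝔞 j) * 𝔞 k ≈ 𝔞 i + 𝔞 j * 𝔞 k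

-- Proof idea: by TPA1 every generator satisfies a ≈ 1 + a, so a * p ≈ (1 + a) * p ≈ p + a * p.
-- Splitting the subsequences of [a₁, …, aₘ] into those that keep a₁ and those that drop it,
-- the sum over nonempty subsequences is a₁ * (a₂ ⋯ aₘ) + (sum over nonempty subsequences of
-- [a₂, …, aₘ]), and the second summand is absorbed by induction.
module Submission where

open import Defs
open import Data.Nat using (ℕ; _≤_)
open import Data.Bool using (not)
open import Data.List using (List; []; _∷_; map; length; _++_; foldr; null; filterᵇ)
open import Data.List.Properties using (filter-++; filter-all; map-++)
open import Data.List.Relation.Unary.All as All using (All; []; _∷_; universal)
open import Data.List.Relation.Unary.All.Properties using (map⁺)
open import Data.Unit using (tt)
open import Algebra.Bundles using (Semiring)
open import Relation.Binary.PropositionalEquality as ≡ using (_≡_)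
import Relation.Binary.Reasoning.Setoid as SetoidReasoning

nonemptySubsequences-∷ : ∀ {a} {A : Set a} (x : A) (xs : List A) →
  nonemptySubsequences (x ∷ xs) ≡ map (x ∷_) (subsequences xs) ++ nonemptySubsequences xs
nonemptySubsequences-∷ x xs = begin
  nonEmpty (map (x ∷_) (subsequences xs) ++ subsequences xs)
    ≡⟨ filter-++ _ (map (x ∷_) (subsequences xs)) (subsequences xs) ⟩
  nonEmpty (map (x ∷_) (subsequences xs)) ++ nonemptySubsequences xs
    ≡⟨ ≡.cong (_++ nonemptySubsequences xs) (filter-all _ (map⁺ (universal (λ _ → tt) _))) ⟩
  map (x ∷_) (subsequences xs) ++ nonemptySubsequences xs ∎
  where
  open ≡.≡-Reasoning
  nonEmpty = filterᵇ (λ s → not (null s))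

module SubsequenceExpansion {c ℓ} (R : Semiring c ℓ) where
  open Semiring R
  open SetoidReasoning setoid

  sum : List Carrier → Carrier
  sum = foldr _+_ 0#

  product : List Carrier → Carrier
  product = foldr _*_ 1#

  sum-++ : ∀ xs ys → sum (xs ++ ys) ≈ sum xs + sum ys
  sum-++ []       ys = sym (+-identityˡ _)
  sum-++ (x ∷ xs) ys = trans (+-cong refl (sum-++ xs ys)) (sym (+-assoc _ _ _))

  sum-map-*ˡ : ∀ a xs → sum (map (a *_) xs) ≈ a * sum xs
  sum-map-*ˡ a []       = sym (zeroʳ a)
  sum-map-*ˡ a (x ∷ xs) = trans (+-cong refl (sum-map-*ˡ a xs)) (sym (distribˡ _ _ _))

  *-absorbsʳ : ∀ {a} p → a ≈ 1# + a → a * p + p ≈ a * p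
  *-absorbsʳ {a} p a≈1+a = begin
    a * p + p         ≈⟨ +-cong refl (sym (*-identityˡ p)) ⟩
    a * p + 1# * p    ≈⟨ +-comm _ _ ⟩
    1# * p + a * p    ≈⟨ sym (distribʳ p 1# a) ⟩
    (1# + a) * p      ≈⟨ *-cong (sym a≈1+a) refl ⟩
    a * p             ∎

  module _ {a} {A : Set a} (f : A → Carrier) where

    monomial : List A → Carrier
    monomial S = product (map f S)

    sum-monomials-map-∷ : ∀ x Ss → sum (map monomial (map (x ∷_) Ss)) ≈ f x * sum (map monomial Ss)
    sum-monomials-map-∷ x Ss = begin
      sum (map monomial (map (x ∷_) Ss))  ≡⟨ ≡.cong sum (≡.sym (map-∘ Ss)) ⟩
      sum (map (f x *_) (map monomial Ss)) ≈⟨ sum-map-*ˡ (f x) (map monomial Ss) ⟩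
      f x * sum (map monomial Ss)          ∎
      where
      map-∘ : ∀ Ss → map (f x *_) (map monomial Ss) ≡ map monomial (map (x ∷_) Ss)
      map-∘ []       = ≡.refl
      map-∘ (S ∷ Ss) = ≡.cong (_ ∷_) (map-∘ Ss)

    sum-monomials-split : ∀ x Ss Ts →
      sum (map monomial (map (x ∷_) Ss ++ Ts)) ≈ f x * sum (map monomial Ss) + sum (map monomial Ts)
    sum-monomials-split x Ss Ts = begin
      sum (map monomial (map (x ∷_) Ss ++ Ts))
        ≡⟨ ≡.cong sum (map-++ monomial (map (x ∷_) Ss) Ts) ⟩
      sum (map monomial (map (x ∷_) Ss) ++ map monomial Ts)
        ≈⟨ sum-++ (map monomial (map (x ∷_) Ss)) (map monomial Ts) ⟩
      sum (map monomial (map (x ∷_) Ss)) + sum (map monomial Ts)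
        ≈⟨ +-cong (sum-monomials-map-∷ x Ss) refl ⟩
      f x * sum (map monomial Ss) + sum (map monomial Ts) ∎

    Absorbing : A → Set ℓ
    Absorbing x = f x ≈ 1# + f x

    sum-subsequences≈product : ∀ xs → All Absorbing xs →
      sum (map monomial (subsequences xs)) ≈ monomial xs
    sum-subsequences≈product []       []         = +-identityʳ 1#
    sum-subsequences≈product (x ∷ xs) (fx ∷ fxs) = begin
      sum (map monomial (subsequences (x ∷ xs)))
        ≈⟨ sum-monomials-split x (subsequences xs) (subsequences xs) ⟩
      f x * sum (map monomial (subsequences xs)) + sum (map monomial (subsequences xs))
        ≈⟨ +-cong (*-cong refl ih) ih ⟩
      f x * monomial xs + monomial xs
        ≈⟨ *-absorbsʳ (monomial xs) fx ⟩
      monomial (x ∷ xs) ∎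
      where ih = sum-subsequences≈product xs fxs

    sum-nonemptySubsequences≈product : ∀ x xs → All Absorbing (x ∷ xs) →
      sum (map monomial (nonemptySubsequences (x ∷ xs))) ≈ monomial (x ∷ xs)
    sum-nonemptySubsequences≈product x xs (fx ∷ fxs) = begin
      sum (map monomial (nonemptySubsequences (x ∷ xs)))
        ≡⟨ ≡.cong (λ Ss → sum (map monomial Ss)) (nonemptySubsequences-∷ x xs) ⟩
      sum (map monomial (map (x ∷_) (subsequences xs) ++ nonemptySubsequences xs))
        ≈⟨ sum-monomials-split x (subsequences xs) (nonemptySubsequences xs) ⟩
      f x * sum (map monomial (subsequences xs)) + sum (map monomial (nonemptySubsequences xs))
        ≈⟨ +-cong (*-cong refl (sum-subsequences≈product xs fxs)) refl ⟩
      f x * monomial xs + sum (map monomial (nonemptySubsequences xs))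
        ≈⟨ absorbTail xs fxs ⟩
      monomial (x ∷ xs) ∎
      where
      absorbTail : ∀ xs → All Absorbing xs →
        f x * monomial xs + sum (map monomial (nonemptySubsequences xs)) ≈ monomial (x ∷ xs)
      absorbTail []       []  = +-identityʳ _
      absorbTail (y ∷ ys) fys =
        trans (+-cong refl (sum-nonemptySubsequences≈product y ys fys)) (*-absorbsʳ _ fx)

theorem2p10 : ∀ {c ℓ} (I : ℕ → Set) (P : TropicalPlacticAlgebra {c} {ℓ} I) →
    let open TropicalPlacticAlgebra P in
    (L : List ℕ) → 1 ≤ length L → All I L → Nondecreasing L →
    Π⟨ map 𝔞 L ⟩ ≈ Σ⟨ map (λ S → Π⟨ map 𝔞 S ⟩) (nonemptySubsequences L) ⟩
theorem2p10 I P (ℓ₁ ∷ L) _ IL _ =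
  sym (sum-nonemptySubsequences≈product 𝔞 ℓ₁ L (All.map (λ {i} → TPA1 i) IL))
  where
  open TropicalPlacticAlgebra P using (semiring; sym; 𝔞; TPA1)
  open SubsequenceExpansion semiring
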